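{- Every contact$^-$ poset $(P,\leq,\delta)$ can be embedded into a contact$^-$ poset whose contact$^-$ relation is the overlap relation. Likewise, every contact$^-$ semilattice $(S,+,\delta)$ can be embedded (as a contact$^-$ semilattice) into a contact$^-$ semilattice whose contact$^-$ relation is the overlap relation.
   Context: A poset here is a partially ordered set with a minimum element $0$. A contact$^-$ relation on a poset $(P,\leq)$ is a binary relation $\delta$ on $P$ such that for all $n,a,b,a_1,b_1\in P$: (Sym) $a\,\delta\, b \Leftrightarrow b\,\delta\, a$; (Emp) $a\,\delta\, b \Rightarrow a>0$ and $b>0$; (Ext) if $a\,\delta\, b$, $a\leq a_1$ and $b\leq b_1$ then $a_1\,\delta\, b_1$; (Ref) $n\neq 0\Rightarrow n\,\delta\, n$. A contact$^-$ poset is a structure $(P,\leq,\delta)$ with $(P,\leq)$ a poset and $\delta$ a contact$^-$ relation on it. A semilattice is a join semilattice with least element $0$, with order $a\leq b$ iff $a+b=b$; a contact$^-$ semilattice is $(S,+,\delta)$ with $\delta$ a contact$^-$ relation on the associated poset. The overlap contact$^-$ relation on a poset with $0$ is defined by $a\,\delta\, b$ iff there is $n>0$ with $n\leq a$ and $n\leq b$. An embedding of contact$^-$ posets is an injective, order-preserving, $0$-preserving map $\varphi$ such that $a\,\delta\, b$ iff $\varphi(a)\,\delta\,\varphi(b)$ for all $a,b$ in the domain; for contact$^-$ semilattices, an embedding is additionally required to preserve $+$. -}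

module Defs where

open import Level using (Level; _⊔_; suc)
open import Data.Product using (Σ; _×_; ∃; ∃-syntax; _,_)
open import Relation.Nullary using (¬_)
open import Relation.Binary using (Rel; Poset)
import Algebra.Lattice.Bundles as AL

private
  variable
    c ℓ₁ ℓ₂ ℓ₃ c′ ℓ₁′ ℓ₂′ ℓ₃′ : Level

-- Contact⁻ axioms for a relation δ on a carrier with equality _≈_,
-- order _≤_ and least element 0#.  "a > 0" is read as ¬ (a ≈ 0#)
-- (in presence of 0# ≤ a this is exactly 0# < a).

record IsContact⁻ {A : Set c} (_≈_ : Rel A ℓ₁) (_≤_ : Rel A ℓ₂) (0# : A)
                  (δ : Rel A ℓ₃) : Set (c ⊔ ℓ₁ ⊔ ℓ₂ ⊔ ℓ₃) where
  field
    sym  : ∀ {a b} → δ a b → δ b a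
    emp  : ∀ {a b} → δ a b → (¬ (a ≈ 0#)) × (¬ (b ≈ 0#))
    ext  : ∀ {a b a₁ b₁} → δ a b → a ≤ a₁ → b ≤ b₁ → δ a₁ b₁
    ref  : ∀ {n} → ¬ (n ≈ 0#) → δ n n

Overlap : {A : Set c} (_≈_ : Rel A ℓ₁) (_≤_ : Rel A ℓ₂) (0# : A) →
          Rel A (c ⊔ ℓ₁ ⊔ ℓ₂)
Overlap _≈_ _≤_ 0# a b = ∃[ n ] ((¬ (n ≈ 0#)) × (n ≤ a) × (n ≤ b))

IsOverlap : {A : Set c} (_≈_ : Rel A ℓ₁) (_≤_ : Rel A ℓ₂) (0# : A)
            (δ : Rel A ℓ₃) → Set (c ⊔ ℓ₁ ⊔ ℓ₂ ⊔ ℓ₃)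
IsOverlap _≈_ _≤_ 0# δ =
  ∀ a b → (δ a b → Overlap _≈_ _≤_ 0# a b) × (Overlap _≈_ _≤_ 0# a b → δ a b)

record ContactPoset c ℓ₁ ℓ₂ ℓ₃ : Set (suc (c ⊔ ℓ₁ ⊔ ℓ₂ ⊔ ℓ₃)) where
  field
    poset : Poset c ℓ₁ ℓ₂
  open Poset poset public
  field
    0#         : Carrier
    minimum    : ∀ x → 0# ≤ x
    δ          : Rel Carrier ℓ₃
    isContact⁻ : IsContact⁻ _≈_ _≤_ 0# δ

  HasOverlapContact : Set (c ⊔ ℓ₁ ⊔ ℓ₂ ⊔ ℓ₃)
  HasOverlapContact = IsOverlap _≈_ _≤_ 0# δ

record PosetEmbedding (P : ContactPoset c ℓ₁ ℓ₂ ℓ₃)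
                      (Q : ContactPoset c′ ℓ₁′ ℓ₂′ ℓ₃′)
                      : Set (c ⊔ ℓ₁ ⊔ ℓ₂ ⊔ ℓ₃ ⊔ c′ ⊔ ℓ₁′ ⊔ ℓ₂′ ⊔ ℓ₃′) where
  private
    module P = ContactPoset P
    module Q = ContactPoset Q
  field
    φ         : P.Carrier → Q.Carrier
    cong      : ∀ {a b} → a P.≈ b → φ a Q.≈ φ b
    injective : ∀ {a b} → φ a Q.≈ φ b → a P.≈ b
    monotone  : ∀ {a b} → a P.≤ b → φ a Q.≤ φ b
    zero      : φ P.0# Q.≈ Q.0#
    contact   : ∀ a b → (P.δ a b → Q.δ (φ a) (φ b)) × (Q.δ (φ a) (φ b) → P.δ a b)

record ContactSemilattice c ℓ₁ ℓ₃ : Set (suc (c ⊔ ℓ₁ ⊔ ℓ₃)) where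
  field
    joinSemilattice : AL.BoundedJoinSemilattice c ℓ₁
  open AL.BoundedJoinSemilattice joinSemilattice public
    renaming (_∨_ to _+_; ⊥ to 0#)

  infix 4 _≤_
  _≤_ : Rel Carrier ℓ₁
  a ≤ b = (a + b) ≈ b

  field
    δ          : Rel Carrier ℓ₃
    isContact⁻ : IsContact⁻ _≈_ _≤_ 0# δ

  HasOverlapContact : Set (c ⊔ ℓ₁ ⊔ ℓ₃)
  HasOverlapContact = IsOverlap _≈_ _≤_ 0# δ

record SemilatticeEmbedding (S : ContactSemilattice c ℓ₁ ℓ₃)
                            (T : ContactSemilattice c′ ℓ₁′ ℓ₃′)
                            : Set (c ⊔ ℓ₁ ⊔ ℓ₃ ⊔ c′ ⊔ ℓ₁′ ⊔ ℓ₃′) where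
  private
    module S = ContactSemilattice S
    module T = ContactSemilattice T
  field
    φ         : S.Carrier → T.Carrier
    cong      : ∀ {a b} → a S.≈ b → φ a T.≈ φ b
    injective : ∀ {a b} → φ a T.≈ φ b → a S.≈ b
    monotone  : ∀ {a b} → a S.≤ b → φ a T.≤ φ b
    zero      : φ S.0# T.≈ T.0#
    +-hom     : ∀ a b → φ (a S.+ b) T.≈ (φ a T.+ φ b)
    contact   : ∀ a b → (S.δ a b → T.δ (φ a) (φ b)) × (T.δ (φ a) (φ b) → S.δ a b)

-- Adjoin to P a new atom ⟨p , q⟩ for every pair p δ q, placed below every
-- element that lies above p or above q.  An element of the extension is an
-- element of P together with finitely many new atoms, so two elements of P
-- acquire a common nonzero lower bound exactly when they were in contact: a
-- shared new atom ⟨p , q⟩ has an end below each of them, and an old nonzero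
-- lower bound n gives contact through n δ n.  For a semilattice the new
-- atoms are joined by concatenating their lists.  Finite lists (rather than
-- arbitrary sets of atoms) make it decidable whether a nonzero lower bound
-- carries a new atom, which the constructive converse needs.
module Submission where

open import Defs
open import Level using (Level; _⊔_; suc)
open import Data.Product using (Σ; _×_; _,_; proj₁; proj₂)
open import Data.Sum using (_⊎_; inj₁; inj₂; [_,_])
open import Data.List using (List; []; _∷_; _++_)
open import Data.List.Membership.Propositional using (_∈_)
open import Data.List.Membership.Propositional.Properties using (∈-++⁺ˡ; ∈-++⁺ʳ; ∈-++⁻)
open import Data.List.Relation.Unary.Any using (here)
open import Function using (_∘_; id)
open import Relation.Nullary using (¬_)
open import Relation.Binary using (Rel; Poset; IsPartialOrder; _⇒_)
open import Relation.Binary.PropositionalEquality using () renaming (refl to ≡-refl)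
import Algebra.Lattice.Bundles as AL
import Relation.Binary.Reasoning.Setoid as SetoidReasoning

module _ {a ℓ₁ ℓ₂} {A : Set a} {_≈_ : Rel A ℓ₁} {_≤_ : Rel A ℓ₂} {0# : A} where

  overlap-mono : ∀ {ℓ₃} {_≤′_ : Rel A ℓ₃} →
                 _≤_ ⇒ _≤′_ → Overlap _≈_ _≤_ 0# ⇒ Overlap _≈_ _≤′_ 0#
  overlap-mono ≤⇒≤′ (n , n≉0 , n≤a , n≤b) = n , n≉0 , ≤⇒≤′ n≤a , ≤⇒≤′ n≤b

  overlap-isContact⁻ : IsPartialOrder _≈_ _≤_ → (∀ x → 0# ≤ x) →
                       IsContact⁻ _≈_ _≤_ 0# (Overlap _≈_ _≤_ 0#)
  overlap-isContact⁻ isPartialOrder minimum = record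
    { sym = λ { (n , n≉0 , n≤a , n≤b) → n , n≉0 , n≤b , n≤a }
    ; emp = λ { (n , n≉0 , n≤a , n≤b) → n≉0 ∘ below-zero n≤a , n≉0 ∘ below-zero n≤b }
    ; ext = λ { (n , n≉0 , n≤a , n≤b) a≤a₁ b≤b₁ → n , n≉0 , trans n≤a a≤a₁ , trans n≤b b≤b₁ }
    ; ref = λ {n} n≉0 → n , n≉0 , refl , refl
    }
    where
    open IsPartialOrder isPartialOrder

    below-zero : ∀ {n x} → n ≤ x → x ≈ 0# → n ≈ 0#
    below-zero n≤x x≈0 = antisym (trans n≤x (reflexive x≈0)) (minimum _)

module JoinOrder {c ℓ} (J : AL.BoundedJoinSemilattice c ℓ) where
  open AL.BoundedJoinSemilattice J
  open SetoidReasoning setoid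

  infix 4 _≤_
  _≤_ : Rel Carrier ℓ
  x ≤ y = x ∨ y ≈ y

  isPartialOrder : IsPartialOrder _≈_ _≤_
  isPartialOrder = record
    { isPreorder = record
      { isEquivalence = isEquivalence
      ; reflexive     = λ {x} {y} x≈y → trans (∨-congʳ x≈y) (idem y)
      ; trans         = ≤-trans
      }
    ; antisym = λ {x} {y} x≤y y≤x → trans (sym y≤x) (trans (comm y x) x≤y)
    }
    where
    ≤-trans : ∀ {x y z} → x ≤ y → y ≤ z → x ≤ z
    ≤-trans {x} {y} {z} x≤y y≤z = begin
      x ∨ z        ≈⟨ ∨-congˡ y≤z ⟨
      x ∨ (y ∨ z)  ≈⟨ assoc x y z ⟨
      (x ∨ y) ∨ z  ≈⟨ ∨-congʳ x≤y ⟩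
      y ∨ z        ≈⟨ y≤z ⟩
      z            ∎

  poset : Poset c ℓ ℓ
  poset = record { isPartialOrder = isPartialOrder }

  ⊥-minimum : ∀ x → ⊥ ≤ x
  ⊥-minimum = identityˡ

  x≤x∨y : ∀ x y → x ≤ x ∨ y
  x≤x∨y x y = trans (sym (assoc x x y)) (∨-congʳ (idem x))

  y≤x∨y : ∀ x y → y ≤ x ∨ y
  y≤x∨y x y = begin
    y ∨ (x ∨ y)  ≈⟨ ∨-congˡ (comm x y) ⟩
    y ∨ (y ∨ x)  ≈⟨ x≤x∨y y x ⟩
    y ∨ x        ≈⟨ comm y x ⟩
    x ∨ y        ∎

contactPoset : ∀ {c ℓ₁ ℓ₃} → ContactSemilattice c ℓ₁ ℓ₃ → ContactPoset c ℓ₁ ℓ₁ ℓ₃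
contactPoset S = record
  { poset      = JoinOrder.poset joinSemilattice
  ; 0#         = 0#
  ; minimum    = JoinOrder.⊥-minimum joinSemilattice
  ; δ          = δ
  ; isContact⁻ = isContact⁻
  }
  where open ContactSemilattice S

module AtomicExtension {c ℓ₁ ℓ₂ ℓ₃} (P : ContactPoset c ℓ₁ ℓ₂ ℓ₃) where
  open ContactPoset P
  private module δ = IsContact⁻ isContact⁻

  L : Level
  L = c ⊔ ℓ₁ ⊔ ℓ₂ ⊔ ℓ₃

  record ContactPair : Set (c ⊔ ℓ₃) where
    constructor ⟨_,_⟩∶_
    field
      left right : Carrier
      inContact  : δ left right
  open ContactPair

  infix 4 _◃_ _∈ᴱ_ _⊆ᴱ_ _⊆ᴬ_ _≈ᴱ_ _≤ᴱ_

  _◃_ : ContactPair → Carrier → Set ℓ₂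
  d ◃ a = left d ≤ a ⊎ right d ≤ a

  ◃-mono : ∀ {d a b} → d ◃ a → a ≤ b → d ◃ b
  ◃-mono (inj₁ p≤a) a≤b = inj₁ (trans p≤a a≤b)
  ◃-mono (inj₂ q≤a) a≤b = inj₂ (trans q≤a a≤b)

  ◃-both⇒δ : ∀ {d a b} → d ◃ a → d ◃ b → δ a b
  ◃-both⇒δ {⟨ p , q ⟩∶ pδq} (inj₁ p≤a) (inj₁ p≤b) = δ.ext (δ.ref (proj₁ (δ.emp pδq))) p≤a p≤b
  ◃-both⇒δ {⟨ p , q ⟩∶ pδq} (inj₁ p≤a) (inj₂ q≤b) = δ.ext pδq p≤a q≤b
  ◃-both⇒δ {⟨ p , q ⟩∶ pδq} (inj₂ q≤a) (inj₁ p≤b) = δ.ext (δ.sym pδq) q≤a p≤b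
  ◃-both⇒δ {⟨ p , q ⟩∶ pδq} (inj₂ q≤a) (inj₂ q≤b) = δ.ext (δ.ref (proj₂ (δ.emp pδq))) q≤a q≤b

  -- Declared one universe up: that is where the theorem places the extension.
  record Ext : Set (suc L) where
    constructor ext
    field
      base  : Carrier
      atoms : List ContactPair
  open Ext public

  _∈ᴱ_ : ContactPair → Ext → Set (c ⊔ ℓ₂ ⊔ ℓ₃)
  d ∈ᴱ x = d ◃ base x ⊎ d ∈ atoms x

  _⊆ᴱ_ : Ext → Ext → Set (c ⊔ ℓ₂ ⊔ ℓ₃)
  x ⊆ᴱ y = ∀ {d} → d ∈ᴱ x → d ∈ᴱ y

  _⊆ᴬ_ : Ext → Ext → Set (c ⊔ ℓ₂ ⊔ ℓ₃)
  x ⊆ᴬ y = ∀ {d} → d ∈ atoms x → d ∈ᴱ y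

  ⊆ᴱ⇒⊆ᴬ : ∀ x {y} → x ⊆ᴱ y → x ⊆ᴬ y
  ⊆ᴱ⇒⊆ᴬ x x⊆y d∈x = x⊆y (inj₂ d∈x)

  ⊆ᴱ-intro : ∀ {x y} → base x ≤ base y → x ⊆ᴬ y → x ⊆ᴱ y
  ⊆ᴱ-intro x≤y listed {d} (inj₁ d◃x) = inj₁ (◃-mono {d} d◃x x≤y)
  ⊆ᴱ-intro x≤y listed (inj₂ d∈x) = listed d∈x

  record _≈ᴱ_ (x y : Ext) : Set (suc L) where
    constructor mk≈ᴱ
    field
      base≈ : base x ≈ base y
      ⊆     : x ⊆ᴱ y
      ⊇     : y ⊆ᴱ x
  open _≈ᴱ_ public

  record _≤ᴱ_ (x y : Ext) : Set (suc L) where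
    constructor mk≤ᴱ
    field
      base≤ : base x ≤ base y
      ⊆     : x ⊆ᴱ y
  open _≤ᴱ_ public

  ≈ᴱ-intro : ∀ {x y} → base x ≈ base y → x ⊆ᴬ y → y ⊆ᴬ x → x ≈ᴱ y
  ≈ᴱ-intro x≈y x⊆y y⊆x =
    mk≈ᴱ x≈y (⊆ᴱ-intro (reflexive x≈y) x⊆y) (⊆ᴱ-intro (reflexive (Eq.sym x≈y)) y⊆x)

  ≈ᴱ-refl : ∀ {x} → x ≈ᴱ x
  ≈ᴱ-refl = mk≈ᴱ Eq.refl id id

  isPartialOrderᴱ : IsPartialOrder _≈ᴱ_ _≤ᴱ_
  isPartialOrderᴱ = record
    { isPreorder = record
      { isEquivalence = record
        { refl  = ≈ᴱ-refl
        ; sym   = λ x≈y → mk≈ᴱ (Eq.sym (base≈ x≈y)) (⊇ x≈y) (_≈ᴱ_.⊆ x≈y)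
        ; trans = λ x≈y y≈z → mk≈ᴱ (Eq.trans (base≈ x≈y) (base≈ y≈z))
                                  (_≈ᴱ_.⊆ y≈z ∘ _≈ᴱ_.⊆ x≈y) (⊇ x≈y ∘ ⊇ y≈z)
        }
      ; reflexive = λ x≈y → mk≤ᴱ (reflexive (base≈ x≈y)) (_≈ᴱ_.⊆ x≈y)
      ; trans     = λ x≤y y≤z → mk≤ᴱ (trans (base≤ x≤y) (base≤ y≤z))
                                     (_≤ᴱ_.⊆ y≤z ∘ _≤ᴱ_.⊆ x≤y)
      }
    ; antisym = λ x≤y y≤x → mk≈ᴱ (antisym (base≤ x≤y) (base≤ y≤x)) (_≤ᴱ_.⊆ x≤y) (_≤ᴱ_.⊆ y≤x)
    }

  ι : Carrier → Ext
  ι a = ext a []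

  0ᴱ : Ext
  0ᴱ = ι 0#

  minimumᴱ : ∀ x → 0ᴱ ≤ᴱ x
  minimumᴱ x = mk≤ᴱ (minimum _) (⊆ᴱ-intro (minimum _) λ ())

  extension : ContactPoset (suc L) (suc L) (suc L) (suc L)
  extension = record
    { poset      = record { isPartialOrder = isPartialOrderᴱ }
    ; 0#         = 0ᴱ
    ; minimum    = minimumᴱ
    ; δ          = Overlap _≈ᴱ_ _≤ᴱ_ 0ᴱ
    ; isContact⁻ = overlap-isContact⁻ isPartialOrderᴱ minimumᴱ
    }

  ι-cong : ∀ {a b} → a ≈ b → ι a ≈ᴱ ι b
  ι-cong a≈b = ≈ᴱ-intro a≈b (λ ()) (λ ())

  ι-mono : ∀ {a b} → a ≤ b → ι a ≤ᴱ ι b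
  ι-mono a≤b = mk≤ᴱ a≤b (⊆ᴱ-intro a≤b λ ())

  ∈ᴱ-ι⁻ : ∀ {d a} → d ∈ᴱ ι a → d ◃ a
  ∈ᴱ-ι⁻ (inj₁ d◃a) = d◃a

  pairAtom : ContactPair → Ext
  pairAtom d = ext 0# (d ∷ [])

  pairAtom≉0ᴱ : ∀ d → ¬ (pairAtom d ≈ᴱ 0ᴱ)
  pairAtom≉0ᴱ (⟨ p , q ⟩∶ pδq) d≈0 with _≈ᴱ_.⊆ d≈0 (inj₂ (here ≡-refl))
  ... | inj₁ (inj₁ p≤0) = proj₁ (δ.emp pδq) (antisym p≤0 (minimum p))
  ... | inj₁ (inj₂ q≤0) = proj₂ (δ.emp pδq) (antisym q≤0 (minimum q))

  pairAtom≤ι : ∀ {d a} → d ◃ a → pairAtom d ≤ᴱ ι a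
  pairAtom≤ι d◃a = mk≤ᴱ (minimum _) (⊆ᴱ-intro (minimum _) λ { (here ≡-refl) → inj₁ d◃a })

  δ⇒overlap-ι : ∀ {a b} → δ a b → Overlap _≈ᴱ_ _≤ᴱ_ 0ᴱ (ι a) (ι b)
  δ⇒overlap-ι {a} {b} aδb =
    pairAtom d , pairAtom≉0ᴱ d , pairAtom≤ι (inj₁ refl) , pairAtom≤ι (inj₂ refl)
    where d = ⟨ a , b ⟩∶ aδb

  overlap-ι⇒δ : ∀ {a b} → Overlap _≈ᴱ_ _≤ᴱ_ 0ᴱ (ι a) (ι b) → δ a b
  overlap-ι⇒δ (ext m [] , n≉0 , n≤a , n≤b) =
    δ.ext (δ.ref λ m≈0 → n≉0 (ι-cong m≈0)) (base≤ n≤a) (base≤ n≤b)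
  overlap-ι⇒δ (ext m (d ∷ _) , n≉0 , n≤a , n≤b) =
    ◃-both⇒δ {d} (∈ᴱ-ι⁻ (_≤ᴱ_.⊆ n≤a (inj₂ (here ≡-refl))))
                 (∈ᴱ-ι⁻ (_≤ᴱ_.⊆ n≤b (inj₂ (here ≡-refl))))

  embedding : PosetEmbedding P extension
  embedding = record
    { φ         = ι
    ; cong      = ι-cong
    ; injective = base≈
    ; monotone  = ι-mono
    ; zero      = ≈ᴱ-refl
    ; contact   = λ a b → δ⇒overlap-ι , overlap-ι⇒δ
    }

module JoinAtomicExtension {c ℓ₁ ℓ₃} (S : ContactSemilattice c ℓ₁ ℓ₃) where
  open ContactSemilattice S
    using (_+_; joinSemilattice; identityˡ; identityʳ; assoc; comm; idem; ∨-cong)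
  open JoinOrder joinSemilattice using (x≤x∨y; y≤x∨y)
  open AtomicExtension (contactPoset S)

  infixr 7 _∨ᴱ_
  _∨ᴱ_ : Ext → Ext → Ext
  x ∨ᴱ y = ext (base x + base y) (atoms x ++ atoms y)

  ⊆ᴱ-∨ˡ : ∀ x y → x ⊆ᴱ x ∨ᴱ y
  ⊆ᴱ-∨ˡ x y {d} (inj₁ d◃x) = inj₁ (◃-mono {d} d◃x (x≤x∨y _ _))
  ⊆ᴱ-∨ˡ x y (inj₂ d∈x) = inj₂ (∈-++⁺ˡ d∈x)

  ⊆ᴱ-∨ʳ : ∀ x y → y ⊆ᴱ x ∨ᴱ y
  ⊆ᴱ-∨ʳ x y {d} (inj₁ d◃y) = inj₁ (◃-mono {d} d◃y (y≤x∨y _ _))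
  ⊆ᴱ-∨ʳ x y (inj₂ d∈y) = inj₂ (∈-++⁺ʳ (atoms x) d∈y)

  ⊆ᴬ-∨ : ∀ x y {z} → x ⊆ᴬ z → y ⊆ᴬ z → x ∨ᴱ y ⊆ᴬ z
  ⊆ᴬ-∨ x y x⊆z y⊆z d∈x∨y = [ x⊆z , y⊆z ] (∈-++⁻ (atoms x) d∈x∨y)

  ∨ᴱ-cong : ∀ {x x′ y y′} → x ≈ᴱ x′ → y ≈ᴱ y′ → x ∨ᴱ y ≈ᴱ x′ ∨ᴱ y′
  ∨ᴱ-cong {x} {x′} {y} {y′} x≈x′ y≈y′ = ≈ᴱ-intro (∨-cong (base≈ x≈x′) (base≈ y≈y′))
    (⊆ᴬ-∨ x y (⊆ᴱ⇒⊆ᴬ x (⊆ᴱ-∨ˡ x′ y′ ∘ _≈ᴱ_.⊆ x≈x′)) (⊆ᴱ⇒⊆ᴬ y (⊆ᴱ-∨ʳ x′ y′ ∘ _≈ᴱ_.⊆ y≈y′)))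
    (⊆ᴬ-∨ x′ y′ (⊆ᴱ⇒⊆ᴬ x′ (⊆ᴱ-∨ˡ x y ∘ ⊇ x≈x′)) (⊆ᴱ⇒⊆ᴬ y′ (⊆ᴱ-∨ʳ x y ∘ ⊇ y≈y′)))

  ∨ᴱ-assoc : ∀ x y z → (x ∨ᴱ y) ∨ᴱ z ≈ᴱ x ∨ᴱ (y ∨ᴱ z)
  ∨ᴱ-assoc x y z = ≈ᴱ-intro (assoc _ _ _)
    (⊆ᴬ-∨ (x ∨ᴱ y) z
      (⊆ᴬ-∨ x y (⊆ᴱ⇒⊆ᴬ x (⊆ᴱ-∨ˡ x (y ∨ᴱ z)))
                (⊆ᴱ⇒⊆ᴬ y (⊆ᴱ-∨ʳ x (y ∨ᴱ z) ∘ ⊆ᴱ-∨ˡ y z)))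
      (⊆ᴱ⇒⊆ᴬ z (⊆ᴱ-∨ʳ x (y ∨ᴱ z) ∘ ⊆ᴱ-∨ʳ y z)))
    (⊆ᴬ-∨ x (y ∨ᴱ z)
      (⊆ᴱ⇒⊆ᴬ x (⊆ᴱ-∨ˡ (x ∨ᴱ y) z ∘ ⊆ᴱ-∨ˡ x y))
      (⊆ᴬ-∨ y z (⊆ᴱ⇒⊆ᴬ y (⊆ᴱ-∨ˡ (x ∨ᴱ y) z ∘ ⊆ᴱ-∨ʳ x y))
                (⊆ᴱ⇒⊆ᴬ z (⊆ᴱ-∨ʳ (x ∨ᴱ y) z))))

  ∨ᴱ-comm : ∀ x y → x ∨ᴱ y ≈ᴱ y ∨ᴱ x
  ∨ᴱ-comm x y = ≈ᴱ-intro (comm _ _)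
    (⊆ᴬ-∨ x y (⊆ᴱ⇒⊆ᴬ x (⊆ᴱ-∨ʳ y x)) (⊆ᴱ⇒⊆ᴬ y (⊆ᴱ-∨ˡ y x)))
    (⊆ᴬ-∨ y x (⊆ᴱ⇒⊆ᴬ y (⊆ᴱ-∨ʳ x y)) (⊆ᴱ⇒⊆ᴬ x (⊆ᴱ-∨ˡ x y)))

  ∨ᴱ-idem : ∀ x → x ∨ᴱ x ≈ᴱ x
  ∨ᴱ-idem x = ≈ᴱ-intro (idem _) (⊆ᴬ-∨ x x inj₂ inj₂) (⊆ᴱ⇒⊆ᴬ x (⊆ᴱ-∨ˡ x x))

  ∨ᴱ-identityˡ : ∀ x → 0ᴱ ∨ᴱ x ≈ᴱ x
  ∨ᴱ-identityˡ x = ≈ᴱ-intro (identityˡ _) inj₂ inj₂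

  ∨ᴱ-identityʳ : ∀ x → x ∨ᴱ 0ᴱ ≈ᴱ x
  ∨ᴱ-identityʳ x = ≈ᴱ-intro (identityʳ _) (⊆ᴬ-∨ x 0ᴱ inj₂ λ ()) (⊆ᴱ⇒⊆ᴬ x (⊆ᴱ-∨ˡ x 0ᴱ))

  joinSemilatticeᴱ : AL.BoundedJoinSemilattice (suc L) (suc L)
  joinSemilatticeᴱ = record
    { _∨_ = _∨ᴱ_
    ; ⊥   = 0ᴱ
    ; isBoundedJoinSemilattice = record
      { isCommutativeMonoid = record
        { isMonoid = record
          { isSemigroup = record
            { isMagma = record
              { isEquivalence = IsPartialOrder.isEquivalence isPartialOrderᴱ
              ; ∙-cong        = ∨ᴱ-cong
              }
            ; assoc = ∨ᴱ-assoc
            }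
          ; identity = ∨ᴱ-identityˡ , ∨ᴱ-identityʳ
          }
        ; comm = ∨ᴱ-comm
        }
      ; idem = ∨ᴱ-idem
      }
    }

  open JoinOrder joinSemilatticeᴱ using (isPartialOrder; ⊥-minimum) renaming (_≤_ to _≤ⱼ_)

  ≤ᴱ⇒≤ⱼ : _≤ᴱ_ ⇒ _≤ⱼ_
  ≤ᴱ⇒≤ⱼ {x} {y} x≤y = ≈ᴱ-intro (base≤ x≤y)
    (⊆ᴬ-∨ x y (⊆ᴱ⇒⊆ᴬ x (_≤ᴱ_.⊆ x≤y)) inj₂) (⊆ᴱ⇒⊆ᴬ y (⊆ᴱ-∨ʳ x y))

  ≤ⱼ⇒≤ᴱ : _≤ⱼ_ ⇒ _≤ᴱ_
  ≤ⱼ⇒≤ᴱ {x} {y} x∨y≈y = mk≤ᴱ (base≈ x∨y≈y) (_≈ᴱ_.⊆ x∨y≈y ∘ ⊆ᴱ-∨ˡ x y)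

  overlapᴱ⇒overlapⱼ : Overlap _≈ᴱ_ _≤ᴱ_ 0ᴱ ⇒ Overlap _≈ᴱ_ _≤ⱼ_ 0ᴱ
  overlapᴱ⇒overlapⱼ = overlap-mono {_≈_ = _≈ᴱ_} {_≤_ = _≤ᴱ_} {0# = 0ᴱ} {_≤′_ = _≤ⱼ_} ≤ᴱ⇒≤ⱼ

  overlapⱼ⇒overlapᴱ : Overlap _≈ᴱ_ _≤ⱼ_ 0ᴱ ⇒ Overlap _≈ᴱ_ _≤ᴱ_ 0ᴱ
  overlapⱼ⇒overlapᴱ = overlap-mono {_≈_ = _≈ᴱ_} {_≤_ = _≤ⱼ_} {0# = 0ᴱ} {_≤′_ = _≤ᴱ_} ≤ⱼ⇒≤ᴱ

  extensionᴶ : ContactSemilattice (suc L) (suc L) (suc L)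
  extensionᴶ = record
    { joinSemilattice = joinSemilatticeᴱ
    ; δ               = Overlap _≈ᴱ_ _≤ⱼ_ 0ᴱ
    ; isContact⁻      = overlap-isContact⁻ isPartialOrder ⊥-minimum
    }

  embeddingᴶ : SemilatticeEmbedding S extensionᴶ
  embeddingᴶ = record
    { φ         = ι
    ; cong      = ι-cong
    ; injective = base≈
    ; monotone  = ι-cong  -- ι a ∨ᴱ ι b is ι (a + b) on the nose
    ; zero      = ≈ᴱ-refl
    ; +-hom     = λ _ _ → ≈ᴱ-refl
    ; contact   = λ a b → overlapᴱ⇒overlapⱼ ∘ δ⇒overlap-ι , overlap-ι⇒δ ∘ overlapⱼ⇒overlapᴱ
    }

proposition2 : ∀ {c ℓ₁ ℓ₂ ℓ₃ c′ ℓ₁′ ℓ₃′ : Level} →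
    (∀ (P : ContactPoset c ℓ₁ ℓ₂ ℓ₃) →
       Σ (ContactPoset (suc (c ⊔ ℓ₁ ⊔ ℓ₂ ⊔ ℓ₃)) (suc (c ⊔ ℓ₁ ⊔ ℓ₂ ⊔ ℓ₃))
                       (suc (c ⊔ ℓ₁ ⊔ ℓ₂ ⊔ ℓ₃)) (suc (c ⊔ ℓ₁ ⊔ ℓ₂ ⊔ ℓ₃)))
         λ Q → ContactPoset.HasOverlapContact Q × PosetEmbedding P Q)
    ×
    (∀ (S : ContactSemilattice c′ ℓ₁′ ℓ₃′) →
       Σ (ContactSemilattice (suc (c′ ⊔ ℓ₁′ ⊔ ℓ₃′)) (suc (c′ ⊔ ℓ₁′ ⊔ ℓ₃′))
                             (suc (c′ ⊔ ℓ₁′ ⊔ ℓ₃′)))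
         λ T → ContactSemilattice.HasOverlapContact T × SemilatticeEmbedding S T)
proposition2 =
  (λ P → let open AtomicExtension P in extension , (λ _ _ → id , id) , embedding) ,
  (λ S → let open JoinAtomicExtension S in extensionᴶ , (λ _ _ → id , id) , embeddingᴶ)
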